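{- Let $(B,\cdot,\circ)$ be a skew left brace with associated solution $(B,\lambda,\rho)$, and assume that the opposite skew left brace $(B,\cdot_{op},\circ)$ is a bi-skew left brace. Then (i) $\mathrm{Ker}\,\rho=\{a\in B:\rho_a=\mathrm{id}_B\}$ is an ideal of $(B,\cdot,\circ)$; (ii) the classes of the relation $\backsim$ (where $x\backsim y$ iff $\rho_x=\rho_y$) are exactly the cosets of $\mathrm{Ker}\,\rho$, so that the right retract $\mathrm{RRet}$ of $(B,\lambda,\rho)$ is the solution associated to the quotient skew left brace $(B,\cdot,\circ)/\mathrm{Ker}\,\rho$.
   Context: A skew left brace is $(B,\cdot,\circ)$ with $(B,\cdot)$ and $(B,\circ)$ groups such that $a\circ(b\cdot c)=(a\circ b)\cdot a^{ -1}\cdot(a\circ c)$; $a^{ -1}$ and $\bar a$ denote inverses in $(B,\cdot)$ and $(B,\circ)$. The opposite skew left brace is $(B,\cdot_{op},\circ)$ with $a\cdot_{op}b=b\cdot a$. A skew left brace $(B,\star,\circ)$ is bi-skew if $(B,\circ,\star)$ is also a skew left brace. The associated solution: $\lambda_a(b)=a^{ -1}\cdot(a\circ b)$, $\rho_b(a)=\overline{\lambda_a(b)}\circ a\circ b$, $r(a,b)=(\lambda_a(b),\rho_b(a))$. An ideal is a subset $I$ that is a normal subgroup of $(B,\cdot)$ and of $(B,\circ)$ with $\lambda_a(I)\subseteq I$ for all $a$; then $a\cdot I=a\circ I$ and these cosets form the quotient skew left brace $B/I$. For a solution whose relation $\backsim$ is a congruence (which holds for right distributive solutions, i.e. $\rho_x\rho_y=\rho_{\rho_x(y)}\rho_x$,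 as is the case here), the right retract $\mathrm{RRet}$ is the induced solution on the set of $\backsim$-classes: $\lambda_{[x]}([y])=[\lambda_x(y)]$, $\rho_{[y]}([x])=[\rho_y(x)]$. -}

module Defs where

open import Level using (0ℓ)
open import Data.Product using (_×_; _,_)
open import Function using (flip)
open import Relation.Binary.PropositionalEquality using (_≡_)
open import Algebra.Structures using (IsGroup)

record IsSkewLeftBrace (B : Set) (_·_ _∘_ : B → B → B) : Set where
  field
    e·       : B
    inv·     : B → B
    isGroup· : IsGroup _≡_ _·_ e· inv·
    e∘       : B
    inv∘     : B → B
    isGroup∘ : IsGroup _≡_ _∘_ e∘ inv∘
    brace    : ∀ a b c → a ∘ (b · c) ≡ ((a ∘ b) · inv· a) · (a ∘ c)

IsBiSkew : (B : Set) → (_⋆_ _∘_ : B → B → B) → Set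
IsBiSkew B _⋆_ _∘_ = IsSkewLeftBrace B _⋆_ _∘_ × IsSkewLeftBrace B _∘_ _⋆_

module SkewBrace {B : Set} {_·_ _∘_ : B → B → B} (br : IsSkewLeftBrace B _·_ _∘_) where
  open IsSkewLeftBrace br

  lam : B → B → B
  lam a b = inv· a · (a ∘ b)

  rho : B → B → B
  rho b a = (inv∘ (lam a b) ∘ a) ∘ b

  Kerρ : B → Set
  Kerρ a = ∀ x → rho a x ≡ x

  _∽_ : B → B → Set
  x ∽ y = ∀ z → rho x z ≡ rho y z

  record IsIdeal (I : B → Set) : Set where
    field
      e·∈    : I e·
      ·-closed : ∀ {x y} → I x → I y → I (x · y)
      inv·∈  : ∀ {x} → I x → I (inv· x)
      normal· : ∀ a {x} → I x → I ((a · x) · inv· a)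
      e∘∈    : I e∘
      ∘-closed : ∀ {x y} → I x → I y → I (x ∘ y)
      inv∘∈  : ∀ {x} → I x → I (inv∘ x)
      normal∘ : ∀ a {x} → I x → I ((a ∘ x) ∘ inv∘ a)
      lam-inv : ∀ a {x} → I x → I (lam a x)

  -- same coset modulo I (x·I = y·I, equivalently x∘I = y∘I for an ideal)
  SameCoset : (B → Set) → B → B → Set
  SameCoset I x y = I (inv· x · y)

  -- operations of the quotient skew brace B/I, computed on representatives
  -- (coset of a·b, coset of a∘b, coset of a⁻¹, coset of ā)
  -- and the solution associated to B/I, on representatives:
  -- λ^{B/I}_{aI}(bI) = (aI)⁻¹ · ((aI) ∘ (bI)),  ρ^{B/I}_{bI}(aI) = ¯(λ^{B/I}_{aI}(bI)) ∘ aI ∘ bI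
  lamQ : B → B → B
  lamQ a b = inv· a · (a ∘ b)

  rhoQ : B → B → B
  rhoQ b a = (inv∘ (lamQ a b) ∘ a) ∘ b

{-# OPTIONS --safe #-}
module Submission where

open import Defs
open import Data.Product using (_×_; _,_)
open import Function using (flip; _⇔_)
open import Function.Bundles using (mk⇔; Equivalence)
open import Relation.Binary.PropositionalEquality using (_≡_; sym; trans; cong; cong₂; module ≡-Reasoning)
open import Algebra.Bundles using (Group)
open import Algebra.Structures using (IsGroup)
import Algebra.Properties.Group as GroupProperties

-- In any skew left brace, λᵒᵖ_a(b) = (a ∘ b) · a⁻¹ (the λ-map of the opposite
-- brace) is a left action of (B,∘), so its inverse ψ_a(x) = ā ∘ (x · a) is a
-- right action of (B,∘); moreover ρ_b(a) = ψ_{λ_a(b)}(a). The bi-skew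
-- hypothesis reads (b ∘ c) · a = ((b · a) ∘ ā) ∘ (c · a) and makes ψ a right
-- action of (B,·) too. Writing a = ψ_a(c) then gives
-- ψ_{λ_a(b)} ψ_a = ψ_{a · λ_a(b)} = ψ_{a ∘ b} = ψ_b ψ_a, i.e. ρ_b = ψ_b.
-- So ρ is a right action of both groups: Ker ρ is its kernel, hence normal in
-- both, x ∽ y iff x⁻¹ · y ∈ Ker ρ, and ρ_{λ_a(x)} = ρ_x ρ_a ρ_{a⁻¹} = ρ_x makes
-- Ker ρ λ-invariant and λ, ρ compatible with ∽.

module IsGroupProperties {G : Set} {_∙_ : G → G → G} {ε : G} {_⁻¹ : G → G}
                         (isGroup : IsGroup _≡_ _∙_ ε _⁻¹) where
  open IsGroup isGroup public using (assoc; identityˡ; identityʳ; inverseˡ; inverseʳ)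

  group : Group _ _
  group = record { isGroup = isGroup }

  open GroupProperties group public

module RightAction {G X : Set} {_∙_ : G → G → G} {ε : G} {_⁻¹ : G → G}
                   (isGroup : IsGroup _≡_ _∙_ ε _⁻¹)
                   (act : G → X → X)
                   (act-∙ : ∀ g h x → act (g ∙ h) x ≡ act h (act g x))
                   (act-ε : ∀ x → act ε x ≡ x) where
  open IsGroupProperties isGroup
  open ≡-Reasoning

  Kernel : G → Set
  Kernel g = ∀ x → act g x ≡ x

  _≈_ : G → G → Set
  g ≈ h = ∀ x → act g x ≡ act h x

  act-⁻¹-act : ∀ g x → act (g ⁻¹) (act g x) ≡ x
  act-⁻¹-act g x = begin
    act (g ⁻¹) (act g x) ≡⟨ act-∙ g (g ⁻¹) x ⟨
    act (g ∙ (g ⁻¹)) x     ≡⟨ cong (λ h → act h x) (inverseʳ g) ⟩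
    act ε x              ≡⟨ act-ε x ⟩
    x                    ∎

  act-act-⁻¹ : ∀ g x → act g (act (g ⁻¹) x) ≡ x
  act-act-⁻¹ g x = begin
    act g (act (g ⁻¹) x) ≡⟨ act-∙ (g ⁻¹) g x ⟨
    act ((g ⁻¹) ∙ g) x     ≡⟨ cong (λ h → act h x) (inverseˡ g) ⟩
    act ε x              ≡⟨ act-ε x ⟩
    x                    ∎

  Kernel-∙ : ∀ {g h} → Kernel g → Kernel h → Kernel (g ∙ h)
  Kernel-∙ {g} {h} kg kh x = trans (act-∙ g h x) (trans (cong (act h) (kg x)) (kh x))

  Kernel-⁻¹ : ∀ {g} → Kernel g → Kernel (g ⁻¹)
  Kernel-⁻¹ {g} kg x = trans (cong (act (g ⁻¹)) (sym (kg x))) (act-⁻¹-act g x)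

  Kernel-normal : ∀ g {h} → Kernel h → Kernel ((g ∙ h) ∙ (g ⁻¹))
  Kernel-normal g {h} kh x = begin
    act ((g ∙ h) ∙ (g ⁻¹)) x         ≡⟨ act-∙ (g ∙ h) (g ⁻¹) x ⟩
    act (g ⁻¹) (act (g ∙ h) x)     ≡⟨ cong (act (g ⁻¹)) (act-∙ g h x) ⟩
    act (g ⁻¹) (act h (act g x))   ≡⟨ cong (act (g ⁻¹)) (kh (act g x)) ⟩
    act (g ⁻¹) (act g x)           ≡⟨ act-⁻¹-act g x ⟩
    x                              ∎

  ∙-cong : ∀ {g g′ h h′} → g ≈ g′ → h ≈ h′ → (g ∙ h) ≈ (g′ ∙ h′)
  ∙-cong {g} {g′} {h} {h′} g≈g′ h≈h′ x = begin
    act (g ∙ h) x        ≡⟨ act-∙ g h x ⟩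
    act h (act g x)      ≡⟨ cong (act h) (g≈g′ x) ⟩
    act h (act g′ x)     ≡⟨ h≈h′ (act g′ x) ⟩
    act h′ (act g′ x)    ≡⟨ act-∙ g′ h′ x ⟨
    act (g′ ∙ h′) x      ∎

  ⁻¹-cong : ∀ {g g′} → g ≈ g′ → (g ⁻¹) ≈ (g′ ⁻¹)
  ⁻¹-cong {g} {g′} g≈g′ x = begin
    act (g ⁻¹) x                        ≡⟨ cong (act (g ⁻¹)) (act-act-⁻¹ g′ x) ⟨
    act (g ⁻¹) (act g′ (act (g′ ⁻¹) x)) ≡⟨ cong (act (g ⁻¹)) (g≈g′ (act (g′ ⁻¹) x)) ⟨
    act (g ⁻¹) (act g (act (g′ ⁻¹) x))  ≡⟨ act-⁻¹-act g (act (g′ ⁻¹) x) ⟩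
    act (g′ ⁻¹) x                       ∎

  ≈⇔Kernel-\\ : ∀ g h → g ≈ h ⇔ Kernel ((g ⁻¹) ∙ h)
  ≈⇔Kernel-\\ g h = mk⇔ to from
    where
    to : g ≈ h → Kernel ((g ⁻¹) ∙ h)
    to g≈h x = begin
      act ((g ⁻¹) ∙ h) x       ≡⟨ act-∙ (g ⁻¹) h x ⟩
      act h (act (g ⁻¹) x)   ≡⟨ g≈h (act (g ⁻¹) x) ⟨
      act g (act (g ⁻¹) x)   ≡⟨ act-act-⁻¹ g x ⟩
      x                      ∎
    from : Kernel ((g ⁻¹) ∙ h) → g ≈ h
    from k x = begin
      act g x                      ≡⟨ k (act g x) ⟨
      act ((g ⁻¹) ∙ h) (act g x)     ≡⟨ act-∙ (g ⁻¹) h (act g x) ⟩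
      act h (act (g ⁻¹) (act g x)) ≡⟨ cong (act h) (act-⁻¹-act g x) ⟩
      act h x                      ∎

module SkewLeftBraceProperties {B : Set} {_·_ _∘_ : B → B → B}
                               (br : IsSkewLeftBrace B _·_ _∘_) where
  open IsSkewLeftBrace br
  open SkewBrace br
  module Add = IsGroupProperties isGroup·
  module Mul = IsGroupProperties isGroup∘
  open ≡-Reasoning

  ∘-identityʳ-e· : ∀ a → a ∘ e· ≡ a
  ∘-identityʳ-e· a = trans (Add.inverseˡ-unique w (inv· a) w·a⁻¹≡e·) (Add.⁻¹-involutive a)
    where
    w = a ∘ e·
    w·a⁻¹≡e· : w · inv· a ≡ e·
    w·a⁻¹≡e· = sym (Add.∙-cancelʳ w e· (w · inv· a) (begin
      e· · w                      ≡⟨ Add.identityˡ w ⟩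
      a ∘ e·                      ≡⟨ cong (a ∘_) (Add.identityˡ e·) ⟨
      a ∘ (e· · e·)               ≡⟨ brace a e· e· ⟩
      (w · inv· a) · w            ∎))

  e∘≡e· : e∘ ≡ e·
  e∘≡e· = sym (Mul.identityʳ-unique e∘ e· (∘-identityʳ-e· e∘))

  inv·-∘ : ∀ a b → inv· (a ∘ b) ≡ (inv· a · (a ∘ inv· b)) · inv· a
  inv·-∘ a b = sym (Add.inverseʳ-unique (a ∘ b) _ (begin
    (a ∘ b) · ((inv· a · (a ∘ inv· b)) · inv· a) ≡⟨ Add.assoc _ _ _ ⟨
    ((a ∘ b) · (inv· a · (a ∘ inv· b))) · inv· a ≡⟨ cong (_· inv· a) (Add.assoc _ _ _) ⟨
    (((a ∘ b) · inv· a) · (a ∘ inv· b)) · inv· a ≡⟨ cong (_· inv· a) (brace a b (inv· b)) ⟨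
    (a ∘ (b · inv· b)) · inv· a                  ≡⟨ cong (λ c → (a ∘ c) · inv· a) (Add.inverseʳ b) ⟩
    (a ∘ e·) · inv· a                            ≡⟨ cong (_· inv· a) (∘-identityʳ-e· a) ⟩
    a · inv· a                                   ≡⟨ Add.inverseʳ a ⟩
    e·                                           ∎))

  ·-lam : ∀ a b → a · lam a b ≡ a ∘ b
  ·-lam a b = Add.\\-leftDividesˡ a (a ∘ b)

  lamᵒᵖ : B → B → B
  lamᵒᵖ a b = (a ∘ b) · inv· a

  lamᵒᵖ⁻¹ : B → B → B
  lamᵒᵖ⁻¹ a x = inv∘ a ∘ (x · a)

  lamᵒᵖ⁻¹-lamᵒᵖ : ∀ a b → lamᵒᵖ⁻¹ a (lamᵒᵖ a b) ≡ b
  lamᵒᵖ⁻¹-lamᵒᵖ a b = trans (cong (inv∘ a ∘_) (Add.//-rightDividesˡ a (a ∘ b)))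
                             (Mul.\\-leftDividesʳ a b)

  lamᵒᵖ-lamᵒᵖ⁻¹ : ∀ a x → lamᵒᵖ a (lamᵒᵖ⁻¹ a x) ≡ x
  lamᵒᵖ-lamᵒᵖ⁻¹ a x = trans (cong (_· inv· a) (Mul.\\-leftDividesˡ a (x · a)))
                             (Add.//-rightDividesʳ a x)

  lamᵒᵖ-∘ : ∀ a b c → lamᵒᵖ a (lamᵒᵖ b c) ≡ lamᵒᵖ (a ∘ b) c
  lamᵒᵖ-∘ a b c = begin
    (a ∘ ((b ∘ c) · inv· b)) · inv· a                      ≡⟨ cong (_· inv· a) (brace a (b ∘ c) (inv· b)) ⟩
    (((a ∘ (b ∘ c)) · inv· a) · (a ∘ inv· b)) · inv· a     ≡⟨ cong (_· inv· a) (Add.assoc _ _ _) ⟩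
    ((a ∘ (b ∘ c)) · (inv· a · (a ∘ inv· b))) · inv· a     ≡⟨ Add.assoc _ _ _ ⟩
    (a ∘ (b ∘ c)) · ((inv· a · (a ∘ inv· b)) · inv· a)     ≡⟨ cong₂ _·_ (Mul.assoc a b c) (inv·-∘ a b) ⟨
    ((a ∘ b) ∘ c) · inv· (a ∘ b)                           ∎

  lamᵒᵖ⁻¹-∘ : ∀ a b x → lamᵒᵖ⁻¹ (a ∘ b) x ≡ lamᵒᵖ⁻¹ b (lamᵒᵖ⁻¹ a x)
  lamᵒᵖ⁻¹-∘ a b x = begin
    lamᵒᵖ⁻¹ (a ∘ b) x                                               ≡⟨ cong (lamᵒᵖ⁻¹ (a ∘ b)) (lamᵒᵖ-lamᵒᵖ⁻¹ a x) ⟨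
    lamᵒᵖ⁻¹ (a ∘ b) (lamᵒᵖ a (lamᵒᵖ⁻¹ a x))                         ≡⟨ cong (λ y → lamᵒᵖ⁻¹ (a ∘ b) (lamᵒᵖ a y)) (lamᵒᵖ-lamᵒᵖ⁻¹ b _) ⟨
    lamᵒᵖ⁻¹ (a ∘ b) (lamᵒᵖ a (lamᵒᵖ b (lamᵒᵖ⁻¹ b (lamᵒᵖ⁻¹ a x))))  ≡⟨ cong (lamᵒᵖ⁻¹ (a ∘ b)) (lamᵒᵖ-∘ a b _) ⟩
    lamᵒᵖ⁻¹ (a ∘ b) (lamᵒᵖ (a ∘ b) (lamᵒᵖ⁻¹ b (lamᵒᵖ⁻¹ a x)))      ≡⟨ lamᵒᵖ⁻¹-lamᵒᵖ (a ∘ b) _ ⟩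
    lamᵒᵖ⁻¹ b (lamᵒᵖ⁻¹ a x)                                         ∎

  lamᵒᵖ⁻¹-e· : ∀ x → lamᵒᵖ⁻¹ e· x ≡ x
  lamᵒᵖ⁻¹-e· x = begin
    inv∘ e· ∘ (x · e·) ≡⟨ cong₂ (λ e y → inv∘ e ∘ y) (sym e∘≡e·) (Add.identityʳ x) ⟩
    inv∘ e∘ ∘ x        ≡⟨ cong (_∘ x) Mul.ε⁻¹≈ε ⟩
    e∘ ∘ x             ≡⟨ Mul.identityˡ x ⟩
    x                  ∎

  rho≡lamᵒᵖ⁻¹-lam : ∀ b a → rho b a ≡ lamᵒᵖ⁻¹ (lam a b) a
  rho≡lamᵒᵖ⁻¹-lam b a = trans (Mul.assoc _ _ _) (cong (inv∘ (lam a b) ∘_) (sym (·-lam a b)))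

module OppositeBiSkew {B : Set} {_·_ _∘_ : B → B → B}
                      (br : IsSkewLeftBrace B _·_ _∘_)
                      (br′ : IsSkewLeftBrace B _∘_ (flip _·_)) where
  open IsSkewLeftBrace br
  open SkewBrace br
  open SkewLeftBraceProperties br
  module Mul′ = IsGroupProperties (IsSkewLeftBrace.isGroup· br′)
  open ≡-Reasoning

  ∘-·-distribʳ : ∀ a b c → (b ∘ c) · a ≡ ((b · a) ∘ inv∘ a) ∘ (c · a)
  ∘-·-distribʳ a b c = trans (IsSkewLeftBrace.brace br′ a b c)
                             (cong (λ ā → ((b · a) ∘ ā) ∘ (c · a)) inv′≡inv∘)
    where
    e′≡e∘ : IsSkewLeftBrace.e· br′ ≡ e∘
    e′≡e∘ = Mul.identityʳ-unique e∘ _ (Mul′.identityʳ e∘)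
    inv′≡inv∘ : IsSkewLeftBrace.inv· br′ a ≡ inv∘ a
    inv′≡inv∘ = Mul.inverseʳ-unique a _ (trans (Mul′.inverseʳ a) e′≡e∘)

  inv∘-· : ∀ a b → inv∘ (a · b) ≡ inv∘ b ∘ ((inv∘ a · b) ∘ inv∘ b)
  inv∘-· a b = sym (Mul.inverseˡ-unique _ (a · b) (begin
    (inv∘ b ∘ ((inv∘ a · b) ∘ inv∘ b)) ∘ (a · b) ≡⟨ Mul.assoc _ _ _ ⟩
    inv∘ b ∘ (((inv∘ a · b) ∘ inv∘ b) ∘ (a · b)) ≡⟨ cong (inv∘ b ∘_) (∘-·-distribʳ b (inv∘ a) a) ⟨
    inv∘ b ∘ ((inv∘ a ∘ a) · b)                  ≡⟨ cong (λ e → inv∘ b ∘ (e · b)) (trans (Mul.inverseˡ a) e∘≡e·) ⟩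
    inv∘ b ∘ (e· · b)                            ≡⟨ cong (inv∘ b ∘_) (Add.identityˡ b) ⟩
    inv∘ b ∘ b                                   ≡⟨ Mul.inverseˡ b ⟩
    e∘                                           ∎))

  lamᵒᵖ⁻¹-· : ∀ a b x → lamᵒᵖ⁻¹ (a · b) x ≡ lamᵒᵖ⁻¹ b (lamᵒᵖ⁻¹ a x)
  lamᵒᵖ⁻¹-· a b x = begin
    inv∘ (a · b) ∘ (x · (a · b))                               ≡⟨ cong₂ _∘_ (inv∘-· a b) (sym (Add.assoc x a b)) ⟩
    (inv∘ b ∘ ((inv∘ a · b) ∘ inv∘ b)) ∘ ((x · a) · b)         ≡⟨ Mul.assoc _ _ _ ⟩
    inv∘ b ∘ (((inv∘ a · b) ∘ inv∘ b) ∘ ((x · a) · b))         ≡⟨ cong (inv∘ b ∘_) (∘-·-distribʳ b (inv∘ a) (x · a)) ⟨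
    inv∘ b ∘ ((inv∘ a ∘ (x · a)) · b)                          ∎

  rho≡lamᵒᵖ⁻¹ : ∀ b a → rho b a ≡ lamᵒᵖ⁻¹ b a
  rho≡lamᵒᵖ⁻¹ b a = begin
    rho b a                                  ≡⟨ rho≡lamᵒᵖ⁻¹-lam b a ⟩
    lamᵒᵖ⁻¹ (lam a b) a                      ≡⟨ cong (lamᵒᵖ⁻¹ (lam a b)) (lamᵒᵖ⁻¹-lamᵒᵖ a a) ⟨
    lamᵒᵖ⁻¹ (lam a b) (lamᵒᵖ⁻¹ a c)          ≡⟨ lamᵒᵖ⁻¹-· a (lam a b) c ⟨
    lamᵒᵖ⁻¹ (a · lam a b) c                  ≡⟨ cong (λ d → lamᵒᵖ⁻¹ d c) (·-lam a b) ⟩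
    lamᵒᵖ⁻¹ (a ∘ b) c                        ≡⟨ lamᵒᵖ⁻¹-∘ a b c ⟩
    lamᵒᵖ⁻¹ b (lamᵒᵖ⁻¹ a c)                  ≡⟨ cong (lamᵒᵖ⁻¹ b) (lamᵒᵖ⁻¹-lamᵒᵖ a a) ⟩
    lamᵒᵖ⁻¹ b a                              ∎
    where
    c = lamᵒᵖ a a

  rho-compose : ∀ c a b → (∀ x → lamᵒᵖ⁻¹ c x ≡ lamᵒᵖ⁻¹ b (lamᵒᵖ⁻¹ a x)) →
                ∀ x → rho c x ≡ rho b (rho a x)
  rho-compose c a b lamᵒᵖ⁻¹-c x = begin
    rho c x                   ≡⟨ rho≡lamᵒᵖ⁻¹ c x ⟩
    lamᵒᵖ⁻¹ c x               ≡⟨ lamᵒᵖ⁻¹-c x ⟩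
    lamᵒᵖ⁻¹ b (lamᵒᵖ⁻¹ a x)   ≡⟨ cong (lamᵒᵖ⁻¹ b) (rho≡lamᵒᵖ⁻¹ a x) ⟨
    lamᵒᵖ⁻¹ b (rho a x)       ≡⟨ rho≡lamᵒᵖ⁻¹ b (rho a x) ⟨
    rho b (rho a x)           ∎

  rho-· : ∀ a b x → rho (a · b) x ≡ rho b (rho a x)
  rho-· a b = rho-compose (a · b) a b (lamᵒᵖ⁻¹-· a b)

  rho-∘ : ∀ a b x → rho (a ∘ b) x ≡ rho b (rho a x)
  rho-∘ a b = rho-compose (a ∘ b) a b (lamᵒᵖ⁻¹-∘ a b)

  rho-e· : ∀ x → rho e· x ≡ x
  rho-e· x = trans (rho≡lamᵒᵖ⁻¹ e· x) (lamᵒᵖ⁻¹-e· x)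

  rho-e∘ : ∀ x → rho e∘ x ≡ x
  rho-e∘ x = trans (cong (λ e → rho e x) e∘≡e·) (rho-e· x)

  module Add-action = RightAction isGroup· rho rho-· rho-e·
  module Mul-action = RightAction isGroup∘ rho rho-∘ rho-e∘

  lam∽ : ∀ a x → lam a x ∽ x
  lam∽ a x z = begin
    rho (inv· a · (a ∘ x)) z           ≡⟨ rho-· (inv· a) (a ∘ x) z ⟩
    rho (a ∘ x) (rho (inv· a) z)       ≡⟨ rho-∘ a x (rho (inv· a) z) ⟩
    rho x (rho a (rho (inv· a) z))     ≡⟨ cong (rho x) (Add-action.act-act-⁻¹ a z) ⟩
    rho x z                            ∎

  lam-cong : ∀ {x y x′ y′} → y ∽ y′ → lam x y ∽ lam x′ y′
  lam-cong {x} {y} {x′} {y′} y∽y′ z = trans (lam∽ x y z) (trans (y∽y′ z) (sym (lam∽ x′ y′ z)))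

  rho-cong : ∀ {x y x′ y′} → x ∽ x′ → y ∽ y′ → rho y x ∽ rho y′ x′
  rho-cong {x} {y} x∽x′ y∽y′ =
    Mul-action.∙-cong (Mul-action.∙-cong (Mul-action.⁻¹-cong (lam-cong {x} y∽y′)) x∽x′) y∽y′

  Kerρ-isIdeal : IsIdeal Kerρ
  Kerρ-isIdeal = record
    { e·∈      = rho-e·
    ; ·-closed = Add-action.Kernel-∙
    ; inv·∈    = Add-action.Kernel-⁻¹
    ; normal·  = Add-action.Kernel-normal
    ; e∘∈      = rho-e∘
    ; ∘-closed = Mul-action.Kernel-∙
    ; inv∘∈    = Mul-action.Kernel-⁻¹
    ; normal∘  = Mul-action.Kernel-normal
    ; lam-inv  = λ a {x} x∈K z → trans (lam∽ a x z) (x∈K z)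
    }

  ∽⇔SameCoset : ∀ x y → x ∽ y ⇔ SameCoset Kerρ x y
  ∽⇔SameCoset = Add-action.≈⇔Kernel-\\

  ∽⇒SameCoset : ∀ {x y} → x ∽ y → SameCoset Kerρ x y
  ∽⇒SameCoset {x} {y} = Equivalence.to (∽⇔SameCoset x y)

theorem5p15 : (B : Set) (_·_ _∘_ : B → B → B) (br : IsSkewLeftBrace B _·_ _∘_) →
    IsBiSkew B (flip _·_) _∘_ →
    let open SkewBrace br in
    IsIdeal Kerρ
    × (∀ x y → (x ∽ y) ⇔ SameCoset Kerρ x y)
    × (∀ x y x′ y′ → x ∽ x′ → y ∽ y′ →
         SameCoset Kerρ (lam x y) (lamQ x′ y′) × SameCoset Kerρ (rho y x) (rhoQ y′ x′))
theorem5p15 B _·_ _∘_ br (_ , br′) =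
  Kerρ-isIdeal , ∽⇔SameCoset , λ x y x′ y′ x∽x′ y∽y′ →
    ∽⇒SameCoset (lam-cong {x} {y} {x′} {y′} y∽y′) , ∽⇒SameCoset (rho-cong x∽x′ y∽y′)
  where
  open OppositeBiSkew br br′
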